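{- Let $d\ge 0$ be an integer and $n=\lfloor d/2\rfloor$. Let $M^{(\gamma)}_d$ be the $(d+1)\times(n+1)$ matrix with entries $$M^{(\gamma)}_d(i,k)=\sum_{j}\binom{k}{i-k-j}\binom{d-2k}{j}2^j,\qquad 0\le i\le d,\ 0\le k\le n.$$ Then $M^{(\gamma)}_d$ is totally non-negative.
   Context: Binomial coefficients follow the convention $\binom{a}{b}=0$ whenever $b<0$ or $b>a$ (for integers $a\ge 0$); the sum over $j$ runs over all integers (only finitely many terms are non-zero). The matrix $M^{(\gamma)}_d$ is the matrix expressing the coefficients $f_i$ of $\sum_i f_i t^{d-i}=\sum_{k=0}^{n}\gamma_k(1+t)^k(2+t)^{d-2k}$ in terms of $\gamma_0,\dots,\gamma_n$. A matrix is totally non-negative if all of its minors are non-negative. -}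

module Defs where

open import Data.Nat as ℕ using (ℕ; zero; suc; _+_; _*_; _∸_; _^_; _≤ᵇ_; _/_)
open import Data.Nat.Combinatorics using (_C_)
open import Data.Bool using (if_then_else_)
open import Data.Fin as Fin using (Fin; toℕ; punchIn)
open import Data.Integer as ℤ using (ℤ)
open import Data.List using (List; map; upTo; allFin)
open import Data.Nat.ListAction using (sum)
open import Data.Product using (Σ; _×_)

-- Binomial with the convention binom a b = 0 for b < 0 (encoded by a guard),
-- and for b > a (stdlib's _C_ returns 0 then).
-- Non-zero terms require 0 ≤ j ≤ d-2k, and i-k-j ≥ 0 (i.e. k + j ≤ i).
gammaTerm : ℕ → ℕ → ℕ → ℕ → ℕ
gammaTerm d i k j =
  if (k + j) ≤ᵇ i
  then (k C (i ∸ (k + j))) * ((d ∸ 2 * k) C j) * 2 ^ j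
  else 0

gammaEntry : ℕ → ℕ → ℕ → ℕ
gammaEntry d i k = sum (map (gammaTerm d i k) (upTo (suc (d ∸ 2 * k))))

Mγ : (d : ℕ) → Fin (suc d) → Fin (suc (d / 2)) → ℤ
Mγ d i k = ℤ.+ (gammaEntry d (toℕ i) (toℕ k))

sumFin : (m : ℕ) → (Fin m → ℤ) → ℤ
sumFin m f = Data.List.foldr ℤ._+_ (ℤ.+ 0) (map f (allFin m))
  where import Data.List

sign : ℕ → ℤ
sign zero = ℤ.+ 1
sign (suc n) = ℤ.- sign n

det : (m : ℕ) → (Fin m → Fin m → ℤ) → ℤ
det zero A = ℤ.+ 1
det (suc m) A =
  sumFin (suc m) λ j →
    sign (toℕ j) ℤ.* A Fin.zero j ℤ.* det m (λ a b → A (Fin.suc a) (punchIn j b))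

StrictlyIncreasing : {m n : ℕ} → (Fin m → Fin n) → Set
StrictlyIncreasing {m} f = ∀ (a b : Fin m) → a Fin.< b → f a Fin.< f b

minor : {p q : ℕ} → (Fin p → Fin q → ℤ) → (m : ℕ) → (Fin m → Fin p) → (Fin m → Fin q) → ℤ
minor A m r c = det m (λ a b → A (r a) (c b))

TotallyNonNegative : {p q : ℕ} → (Fin p → Fin q → ℤ) → Set
TotallyNonNegative {p} {q} A =
  ∀ (m : ℕ) (r : Fin m → Fin p) (c : Fin m → Fin q) →
    StrictlyIncreasing r → StrictlyIncreasing c → ℤ.+ 0 ℤ.≤ minor A m r c

module Submission where

-- Column k of M^(γ)_d lists the coefficients of (1 + t)^k (2 + t)^(d - 2k) from
-- t^d downwards, that is, those of x^k (1 + x)^k (1 + 2x)^(d - 2k) from x^0 upwards.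
-- Adding c ≥ 0 times column k + 1 to column k preserves total non-negativity: by
-- linearity a minor through column k becomes itself plus c times the minor through
-- column k + 1 instead, which is either again a minor or has two equal adjacent
-- columns. Starting from the identity matrix, whose columns are x^k, such
-- operations multiply every column by 1 + 2x (d mod 2 times), then the columns
-- k ≥ a by 1 + x for a = 1, …, ⌊d/2⌋, and finally, as (1 + 2x)² = 1 + 4x(1 + x),
-- the columns k < m by (1 + 2x)² for m = ⌊d/2⌋, …, 1. The matrices are infinite,
-- so that every column has a next one.

open import Defs
open import Data.Nat as ℕ using (ℕ; zero; suc; z≤n; s≤s)
import Data.Nat.Properties as ℕₚ
open import Data.Integer as ℤ using (ℤ; +_; 0ℤ)
import Data.Integer.Properties as ℤₚ
open import Algebra.Bundles using (Semiring)
open import Data.Fin as Fin using (Fin; zero; suc; toℕ; punchIn; punchOut; inject₁)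
import Data.Fin.Properties as Finₚ
import Data.List as List
import Data.List.Properties as Listₚ
import Data.Nat.ListAction as ListAction
open import Data.Product using (∃-syntax; _×_; _,_)
open import Data.Empty using (⊥-elim)
open import Data.Sum using (_⊎_; inj₁; inj₂)
open import Data.Bool using (true; false; if_then_else_)
open import Function using (id; _∘_)
open import Relation.Nullary using (yes; no)
open import Relation.Binary.PropositionalEquality
open import Relation.Binary.Core using (_Preserves_⟶_)
open import Relation.Binary.Definitions using (tri<; tri≈; tri>)
open import Data.Vec.Functional using (updateAt)
open import Data.Vec.Functional.Properties using (updateAt-updates; updateAt-minimal)

module _ {c ℓ} (R : Semiring c ℓ) where
  open Semiring R using (Carrier; _≈_; _+_; _*_; 0#; +-congˡ) renaming (trans to ≈-trans; sym to ≈-sym)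
  open import Algebra.Properties.Semiring.Sum R using (sum; sum-cong-≋; sum-replicate-zero; ∑-distrib-+; *-distribˡ-sum)

  sum-linear : ∀ {m} (f g : Fin m → Carrier) k → sum (λ j → f j + k * g j) ≈ sum f + k * sum g
  sum-linear f g k = ≈-trans (∑-distrib-+ f (λ j → k * g j)) (+-congˡ (≈-sym (*-distribˡ-sum k g)))

  sum-zero : ∀ {m} (f : Fin m → Carrier) → (∀ j → f j ≈ 0#) → sum f ≈ 0#
  sum-zero {m} f f≈0 = ≈-trans (sum-cong-≋ f≈0) (sum-replicate-zero m)

Increasing : ∀ {m} → (Fin m → ℕ) → Set
Increasing f = f Preserves Fin._<_ ⟶ ℕ._<_

increasing-injective : ∀ {m} {f : Fin m → ℕ} → Increasing f → ∀ {a b} → f a ≡ f b → a ≡ b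
increasing-injective {f = f} inc {a} {b} fa≡fb with Finₚ.<-cmp a b
... | tri< a<b _ _ = ⊥-elim (ℕₚ.<-irrefl fa≡fb (inc a<b))
... | tri≈ _ a≡b _ = a≡b
... | tri> _ _ b<a = ⊥-elim (ℕₚ.<-irrefl (sym fa≡fb) (inc b<a))

increasing-≥-first : ∀ {m} {f : Fin (suc m) → ℕ} → Increasing f → ∀ b → f zero ℕ.≤ f b
increasing-≥-first inc zero = ℕₚ.≤-refl
increasing-≥-first inc (suc b) = ℕₚ.<⇒≤ (inc (s≤s z≤n))

increasing-≤-last : ∀ {m} {f : Fin (suc m) → ℕ} → Increasing f → ∀ b → f b ℕ.≤ f (Fin.fromℕ m)
increasing-≤-last {m} {f} inc b with b Fin.≟ Fin.fromℕ m
... | yes refl = ℕₚ.≤-refl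
... | no b≢last = ℕₚ.<⇒≤ (inc (Finₚ.≤∧≢⇒< (Finₚ.≤fromℕ b) b≢last))

increasing-consecutive : ∀ {m} {f : Fin (suc m) → ℕ} → Increasing f → ∀ b b′ → f b′ ≡ suc (f b) →
  ∃[ s ] b ≡ inject₁ s × b′ ≡ suc s
increasing-consecutive inc zero zero e = ⊥-elim (ℕₚ.1+n≢n (sym e))
increasing-consecutive {suc m} inc zero (suc zero) e = zero , refl , refl
increasing-consecutive {suc m} {f} inc zero (suc (suc b′)) e =
  -- f 1 would lie strictly between f 0 and f 0 + 1
  ⊥-elim (ℕₚ.<⇒≱ (inc {zero} {suc zero} (s≤s z≤n)) (ℕ.s≤s⁻¹ (subst (f (suc zero) ℕ.<_) e (inc (s≤s (s≤s z≤n))))))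
increasing-consecutive inc (suc b) zero e = ⊥-elim (ℕₚ.<-asym (inc {zero} {suc b} (s≤s z≤n)) (ℕₚ.≤-reflexive (sym e)))
increasing-consecutive {suc m} inc (suc b) (suc b′) e
  with s , refl , refl ← increasing-consecutive (inc ∘ s≤s) b b′ e = suc s , refl , refl

increasing-updateAt-suc : ∀ {m} {f : Fin m → ℕ} (b₀ : Fin m) → Increasing f → (∀ b → f b ≢ suc (f b₀)) →
  Increasing (updateAt f b₀ suc)
increasing-updateAt-suc {f = f} b₀ inc missing {a} {b} a<b with a Fin.≟ b₀ | b Fin.≟ b₀
... | yes refl | yes refl = ⊥-elim (Finₚ.<-irrefl refl a<b)
... | yes refl | no b≢a = subst₂ ℕ._<_ (sym (updateAt-updates a f)) (sym (updateAt-minimal b a f b≢a))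
  (ℕₚ.≤∧≢⇒< (inc a<b) (missing b ∘ sym))
... | no a≢b | yes refl = subst₂ ℕ._<_ (sym (updateAt-minimal a b f a≢b)) (sym (updateAt-updates b f))
  (ℕₚ.m<n⇒m<1+n (inc a<b))
... | no a≢b₀ | no b≢b₀ = subst₂ ℕ._<_ (sym (updateAt-minimal a b₀ f a≢b₀)) (sym (updateAt-minimal b b₀ f b≢b₀))
  (inc a<b)

-- Determinants

module Determinant where

  open import Data.Integer using (-_; _+_; _*_)
  open import Data.Integer.Tactic.RingSolver using (solve-∀)
  open import Algebra.Properties.Semiring.Sum ℤₚ.+-*-semiring
    using (sum; sum-cong-≗)

  sumFin≡sum : ∀ m (f : Fin m → ℤ) → sumFin m f ≡ sum f
  sumFin≡sum m f = trans (cong (List.foldr _+_ 0ℤ) (Listₚ.map-tabulate id f)) (foldr-tabulate f)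
    where
    foldr-tabulate : ∀ {m} (g : Fin m → ℤ) → List.foldr _+_ 0ℤ (List.tabulate g) ≡ sum g
    foldr-tabulate {zero} g = refl
    foldr-tabulate {suc m} g = cong (_+_ (g zero)) (foldr-tabulate (g ∘ suc))

  firstRowMinor : ∀ {m} → (Fin (suc m) → Fin (suc m) → ℤ) → Fin (suc m) → Fin m → Fin m → ℤ
  firstRowMinor A j a b = A (suc a) (punchIn j b)

  expansionTerm : ∀ m → (Fin (suc m) → Fin (suc m) → ℤ) → Fin (suc m) → ℤ
  expansionTerm m A j = sign (toℕ j) * A zero j * det m (firstRowMinor A j)

  det-expand : ∀ m (A : Fin (suc m) → Fin (suc m) → ℤ) → det (suc m) A ≡ sum (expansionTerm m A)
  det-expand m A = sumFin≡sum (suc m) (expansionTerm m A)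

  det-cong : ∀ m {A B : Fin m → Fin m → ℤ} → (∀ a b → A a b ≡ B a b) → det m A ≡ det m B
  det-cong zero A≡B = refl
  det-cong (suc m) {A} {B} A≡B = cong (List.foldr _+_ 0ℤ) (Listₚ.map-cong term-cong (List.allFin (suc m)))
    where
    term-cong : ∀ j → expansionTerm m A j ≡ expansionTerm m B j
    term-cong j = cong₂ (λ u v → sign (toℕ j) * u * v) (A≡B zero j)
                        (det-cong m (λ a b → A≡B (suc a) (punchIn j b)))

  expansionTerm-vanishes : ∀ m (A : Fin (suc m) → Fin (suc m) → ℤ) j → A zero j ≡ 0ℤ → expansionTerm m A j ≡ 0ℤ
  expansionTerm-vanishes m A j A₀ⱼ≡0 = begin
    sign (toℕ j) * A zero j * det m (firstRowMinor A j) ≡⟨ cong (λ u → sign (toℕ j) * u * det m (firstRowMinor A j)) A₀ⱼ≡0 ⟩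
    sign (toℕ j) * 0ℤ * det m (firstRowMinor A j)       ≡⟨ cong (_* det m (firstRowMinor A j)) (ℤₚ.*-zeroʳ (sign (toℕ j))) ⟩
    0ℤ * det m (firstRowMinor A j)                      ≡⟨ ℤₚ.*-zeroˡ (det m (firstRowMinor A j)) ⟩
    0ℤ                                                  ∎
    where open ≡-Reasoning

  det-zeroFirstRow : ∀ m (A : Fin (suc m) → Fin (suc m) → ℤ) → (∀ j → A zero j ≡ 0ℤ) → det (suc m) A ≡ 0ℤ
  det-zeroFirstRow m A zero-row =
    trans (det-expand m A) (sum-zero ℤₚ.+-*-semiring (expansionTerm m A) λ j → expansionTerm-vanishes m A j (zero-row j))

  det-unitFirstRow : ∀ m (A : Fin (suc m) → Fin (suc m) → ℤ) → A zero zero ≡ + 1 → (∀ j → A zero (suc j) ≡ 0ℤ) →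
    det (suc m) A ≡ det m (λ a b → A (suc a) (suc b))
  det-unitFirstRow m A A₀₀≡1 zero-rest = begin
    det (suc m) A                                              ≡⟨ det-expand m A ⟩
    + 1 * A zero zero * det m (firstRowMinor A zero) + sum (λ j → expansionTerm m A (suc j))
      ≡⟨ cong₂ (λ u v → + 1 * u * det m (firstRowMinor A zero) + v) A₀₀≡1 (sum-zero ℤₚ.+-*-semiring _ rest-vanishes) ⟩
    + 1 * + 1 * det m (firstRowMinor A zero) + 0ℤ            ≡⟨ ℤₚ.+-identityʳ _ ⟩
    + 1 * det m (firstRowMinor A zero)                       ≡⟨ ℤₚ.*-identityˡ _ ⟩
    det m (λ a b → A (suc a) (suc b))                        ∎
    where
    open ≡-Reasoning
    rest-vanishes : ∀ j → expansionTerm m A (suc j) ≡ 0ℤ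
    rest-vanishes j = expansionTerm-vanishes m A (suc j) (zero-rest j)

  det-linear : ∀ m (b₀ : Fin m) (k : ℤ) (A B C : Fin m → Fin m → ℤ) →
    (∀ a b → b ≢ b₀ → A a b ≡ B a b) → (∀ a b → b ≢ b₀ → A a b ≡ C a b) →
    (∀ a → A a b₀ ≡ B a b₀ + k * C a b₀) → det m A ≡ det m B + k * det m C
  det-linear (suc m) b₀ k A B C A≡B A≡C A≡B+kC = begin
    det (suc m) A                                               ≡⟨ det-expand m A ⟩
    sum (expansionTerm m A)                                     ≡⟨ sum-cong-≗ term-linear ⟩
    sum (λ j → expansionTerm m B j + k * expansionTerm m C j)   ≡⟨ sum-linear ℤₚ.+-*-semiring (expansionTerm m B) (expansionTerm m C) k ⟩
    sum (expansionTerm m B) + k * sum (expansionTerm m C)       ≡⟨ cong₂ (λ u v → u + k * v) (det-expand m B) (det-expand m C) ⟨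
    det (suc m) B + k * det (suc m) C                           ∎
    where
    open ≡-Reasoning
    term-linear : ∀ j → expansionTerm m A j ≡ expansionTerm m B j + k * expansionTerm m C j
    term-linear j with j Fin.≟ b₀
    ... | yes refl = begin
      s * A zero j * det m (firstRowMinor A j)
        ≡⟨ cong₂ (λ u v → s * u * v) (A≡B+kC zero) (det-cong m (λ a b → A≡B (suc a) (punchIn j b) (Finₚ.punchInᵢ≢i j b))) ⟩
      s * (B zero j + k * C zero j) * det m (firstRowMinor B j)
        ≡⟨ distrib s (B zero j) (C zero j) k _ ⟩
      s * B zero j * det m (firstRowMinor B j) + k * (s * C zero j * det m (firstRowMinor B j))
        ≡⟨ cong (λ v → expansionTerm m B j + k * (s * C zero j * v)) (det-cong m minorB≡minorC) ⟩
      expansionTerm m B j + k * expansionTerm m C j ∎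
      where
      s : ℤ
      s = sign (toℕ j)
      distrib : ∀ s x y k d → s * (x + k * y) * d ≡ s * x * d + k * (s * y * d)
      distrib = solve-∀
      minorB≡minorC : ∀ a b → firstRowMinor B j a b ≡ firstRowMinor C j a b
      minorB≡minorC a b = let j≢ = Finₚ.punchInᵢ≢i j b in
        trans (sym (A≡B (suc a) (punchIn j b) j≢)) (A≡C (suc a) (punchIn j b) j≢)
    ... | no j≢b₀ = begin
      s * A zero j * det m (firstRowMinor A j)
        ≡⟨ cong (λ v → s * A zero j * v) minor-linear ⟩
      s * A zero j * (det m (firstRowMinor B j) + k * det m (firstRowMinor C j))
        ≡⟨ distrib s (A zero j) k _ _ ⟩
      s * A zero j * det m (firstRowMinor B j) + k * (s * A zero j * det m (firstRowMinor C j))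
        ≡⟨ cong₂ (λ u v → s * u * det m (firstRowMinor B j) + k * (s * v * det m (firstRowMinor C j)))
                 (A≡B zero j j≢b₀) (A≡C zero j j≢b₀) ⟩
      expansionTerm m B j + k * expansionTerm m C j ∎
      where
      s : ℤ
      s = sign (toℕ j)
      distrib : ∀ s x k d e → s * x * (d + k * e) ≡ s * x * d + k * (s * x * e)
      distrib = solve-∀
      b₀′ : Fin m
      b₀′ = punchOut j≢b₀
      punchIn≢b₀ : ∀ b → b ≢ b₀′ → punchIn j b ≢ b₀
      punchIn≢b₀ b b≢ e = b≢ (Finₚ.punchIn-injective j b b₀′ (trans e (sym (Finₚ.punchIn-punchOut j≢b₀))))
      minor-linear : det m (firstRowMinor A j) ≡ det m (firstRowMinor B j) + k * det m (firstRowMinor C j)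
      minor-linear = det-linear m b₀′ k (firstRowMinor A j) (firstRowMinor B j) (firstRowMinor C j)
        (λ a b b≢ → A≡B (suc a) (punchIn j b) (punchIn≢b₀ b b≢))
        (λ a b b≢ → A≡C (suc a) (punchIn j b) (punchIn≢b₀ b b≢))
        (λ a → subst (λ z → A (suc a) z ≡ B (suc a) z + k * C (suc a) z)
                     (sym (Finₚ.punchIn-punchOut j≢b₀)) (A≡B+kC (suc a)))

  det-zeroColumn : ∀ m (b₀ : Fin m) (A : Fin m → Fin m → ℤ) → (∀ a → A a b₀ ≡ 0ℤ) → det m A ≡ 0ℤ
  det-zeroColumn m b₀ A zero-col = begin
    det m A                                     ≡⟨ add-and-subtract (det m A) ⟩
    det m A + + 1 * det m A + - det m A         ≡⟨ cong (λ u → u + - det m A) A≡A+A ⟨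
    det m A + - det m A                         ≡⟨ ℤₚ.+-inverseʳ (det m A) ⟩
    0ℤ                                          ∎
    where
    open ≡-Reasoning
    add-and-subtract : ∀ x → x ≡ x + + 1 * x + - x
    add-and-subtract = solve-∀
    -- a vanishing column is the sum of itself with itself
    A≡A+A : det m A ≡ det m A + + 1 * det m A
    A≡A+A = det-linear m b₀ (+ 1) A A A (λ _ _ _ → refl) (λ _ _ _ → refl)
              (λ a → subst (λ x → x ≡ x + + 1 * x) (sym (zero-col a)) refl)

  sum-adjacentSupport : ∀ {m} (s : Fin m) (f : Fin (suc m) → ℤ) →
    (∀ x → x ≢ inject₁ s → x ≢ suc s → f x ≡ 0ℤ) → sum f ≡ f (inject₁ s) + f (suc s)
  sum-adjacentSupport {suc m} zero f f≡0
    rewrite sum-zero ℤₚ.+-*-semiring (λ j → f (suc (suc j))) (λ j → f≡0 (suc (suc j)) (λ ()) (λ ())) =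
    cong (_+_ (f zero)) (ℤₚ.+-identityʳ (f (suc zero)))
  sum-adjacentSupport {suc m} (suc s) f f≡0 =
    trans (cong (λ u → u + sum (f ∘ suc)) (f≡0 zero (λ ()) (λ ()))) (trans (ℤₚ.+-identityˡ (sum (f ∘ suc)))
      (sum-adjacentSupport s (f ∘ suc) (λ x x≢ x≢′ → f≡0 (suc x) (x≢ ∘ Finₚ.suc-injective) (x≢′ ∘ Finₚ.suc-injective))))

  punchIn-inject₁-suc : ∀ {m} (s b : Fin m) →
    punchIn (inject₁ s) b ≡ punchIn (suc s) b ⊎
    (punchIn (inject₁ s) b ≡ suc s × punchIn (suc s) b ≡ inject₁ s)
  punchIn-inject₁-suc zero zero = inj₂ (refl , refl)
  punchIn-inject₁-suc zero (suc b) = inj₁ refl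
  punchIn-inject₁-suc (suc s) zero = inj₁ refl
  punchIn-inject₁-suc (suc s) (suc b) with punchIn-inject₁-suc s b
  ... | inj₁ e = inj₁ (cong suc e)
  ... | inj₂ (e , e′) = inj₂ (cong suc e , cong suc e′)

  punchIn-adjacent : ∀ {m} (x : Fin (suc (suc m))) (s : Fin (suc m)) → x ≢ inject₁ s → x ≢ suc s →
    ∃[ s′ ] punchIn x (inject₁ s′) ≡ inject₁ s × punchIn x (suc s′) ≡ suc s
  punchIn-adjacent zero zero x≢ x≢′ = ⊥-elim (x≢ refl)
  punchIn-adjacent {suc m} zero (suc s) x≢ x≢′ = s , refl , refl
  punchIn-adjacent (suc zero) zero x≢ x≢′ = ⊥-elim (x≢′ refl)
  punchIn-adjacent {suc m} (suc (suc x)) zero x≢ x≢′ = zero , refl , refl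
  punchIn-adjacent {suc m} (suc x) (suc s) x≢ x≢′
    with s′ , e , e′ ← punchIn-adjacent x s (x≢ ∘ cong suc) (x≢′ ∘ cong suc) =
    suc s′ , cong suc e , cong suc e′

  det-equalAdjacentColumns : ∀ m (s : Fin m) (A : Fin (suc m) → Fin (suc m) → ℤ) →
    (∀ a → A a (inject₁ s) ≡ A a (suc s)) → det (suc m) A ≡ 0ℤ
  det-equalAdjacentColumns (suc m) s A equal = begin
    det (suc (suc m)) A                                ≡⟨ det-expand (suc m) A ⟩
    sum (expansionTerm (suc m) A)                      ≡⟨ sum-adjacentSupport s _ other-terms ⟩
    expansionTerm (suc m) A (inject₁ s) + expansionTerm (suc m) A (suc s)
      ≡⟨ cong (λ u → u + expansionTerm (suc m) A (suc s)) first-term ⟩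
    σ * A zero (suc s) * det (suc m) (firstRowMinor A (suc s)) + expansionTerm (suc m) A (suc s)
      ≡⟨ cancel σ (A zero (suc s)) (det (suc m) (firstRowMinor A (suc s))) ⟩
    0ℤ                                                 ∎
    where
    open ≡-Reasoning
    σ : ℤ
    σ = sign (toℕ s)
    cancel : ∀ σ a d → σ * a * d + (- σ) * a * d ≡ 0ℤ
    cancel = solve-∀
    same-minor : ∀ a b → firstRowMinor A (inject₁ s) a b ≡ firstRowMinor A (suc s) a b
    same-minor a b with punchIn-inject₁-suc s b
    ... | inj₁ e = cong (A (suc a)) e
    ... | inj₂ (e , e′) rewrite e | e′ = sym (equal (suc a))
    first-term : expansionTerm (suc m) A (inject₁ s) ≡ σ * A zero (suc s) * det (suc m) (firstRowMinor A (suc s))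
    first-term = cong₂ _*_ (cong₂ _*_ (cong sign (Finₚ.toℕ-inject₁ s)) (equal zero)) (det-cong (suc m) same-minor)
    other-terms : ∀ x → x ≢ inject₁ s → x ≢ suc s → expansionTerm (suc m) A x ≡ 0ℤ
    other-terms x x≢ x≢′ with s′ , e , e′ ← punchIn-adjacent x s x≢ x≢′ =
      trans (cong (sign (toℕ x) * A zero x *_) minor-vanishes) (ℤₚ.*-zeroʳ (sign (toℕ x) * A zero x))
      where
      minor-vanishes : det (suc m) (firstRowMinor A x) ≡ 0ℤ
      minor-vanishes = det-equalAdjacentColumns m s′ (firstRowMinor A x) λ a →
        trans (cong (A (suc a)) e) (trans (equal (suc a)) (cong (A (suc a)) (sym e′)))

  det-equalConsecutiveColumns : ∀ m (A : Fin m → Fin m → ℤ) {pos : Fin m → ℕ} → Increasing pos →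
    ∀ b b′ → pos b′ ≡ suc (pos b) → (∀ a → A a b ≡ A a b′) → det m A ≡ 0ℤ
  det-equalConsecutiveColumns (suc m) A inc b b′ consecutive equal
    with s , refl , refl ← increasing-consecutive inc b b′ consecutive = det-equalAdjacentColumns m s A equal

open Determinant
open import Data.Nat using (_+_; _*_; _^_; _∸_; _⊓_; _/_; _%_)
open import Data.Nat.DivMod using (m≡m%n+[m/n]*n)
open import Data.Nat.Combinatorics using (_C_; nCk+nC[k+1]≡[n+1]C[k+1])
open import Data.Nat.Tactic.RingSolver using (solve-∀)
open import Algebra.Properties.Semiring.Sum ℕₚ.+-*-semiring using (sum; sum-cong-≗; sum-replicate-zero)

-- Power series

-- coefficient sequences of formal power series in x
Seq : Set
Seq = ℕ → ℕ

shift : Seq → Seq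
shift g zero = 0
shift g (suc i) = g i

shiftBy : ℕ → Seq → Seq
shiftBy zero g = g
shiftBy (suc k) g = shift (shiftBy k g)

one : Seq
one zero = 1
one (suc i) = 0

shift-cong : ∀ {f g} → f ≗ g → shift f ≗ shift g
shift-cong f≗g zero = refl
shift-cong f≗g (suc i) = f≗g i

shiftBy-cong : ∀ k {f g} → f ≗ g → shiftBy k f ≗ shiftBy k g
shiftBy-cong zero f≗g = f≗g
shiftBy-cong (suc k) f≗g = shift-cong (shiftBy-cong k f≗g)

shiftBy-shiftBy : ∀ j k g → shiftBy j (shiftBy k g) ≗ shiftBy (j + k) g
shiftBy-shiftBy zero k g i = refl
shiftBy-shiftBy (suc j) k g = shift-cong (shiftBy-shiftBy j k g)

shiftBy-≤ᵇ : ∀ k g i → shiftBy k g i ≡ (if k ℕ.≤ᵇ i then g (i ∸ k) else 0)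
shiftBy-≤ᵇ zero g i = refl
shiftBy-≤ᵇ (suc k) g zero = refl
shiftBy-≤ᵇ (suc zero) g (suc i) = refl
shiftBy-≤ᵇ (suc (suc k)) g (suc i) = shiftBy-≤ᵇ (suc k) g i

addShifted : ℕ → Seq → Seq → Seq
addShifted c f g i = f i + c * shift g i

onePlus : ℕ → Seq → Seq
onePlus c g = addShifted c g g

onePlusPow : ℕ → ℕ → Seq → Seq
onePlusPow c zero g = g
onePlusPow c (suc N) g = onePlus c (onePlusPow c N g)

onePlus-cong : ∀ c {f g} → f ≗ g → onePlus c f ≗ onePlus c g
onePlus-cong c f≗g i = cong₂ (λ u v → u + c * v) (f≗g i) (shift-cong f≗g i)

shift-addShifted : ∀ c f g → shift (addShifted c f g) ≗ addShifted c (shift f) (shift g)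
shift-addShifted c f g zero = sym (ℕₚ.*-zeroʳ c)
shift-addShifted c f g (suc i) = refl

shiftBy-addShifted : ∀ k c f g → shiftBy k (addShifted c f g) ≗ addShifted c (shiftBy k f) (shiftBy k g)
shiftBy-addShifted zero c f g i = refl
shiftBy-addShifted (suc k) c f g i =
  trans (shift-cong (shiftBy-addShifted k c f g) i) (shift-addShifted c (shiftBy k f) (shiftBy k g) i)

shiftBy-onePlusPow : ∀ k c N g → shiftBy k (onePlusPow c N g) ≗ onePlusPow c N (shiftBy k g)
shiftBy-onePlusPow k c zero g i = refl
shiftBy-onePlusPow k c (suc N) g i =
  trans (shiftBy-addShifted k c _ _ i) (onePlus-cong c (shiftBy-onePlusPow k c N g) i)

onePlus-comm : ∀ a b g → onePlus a (onePlus b g) ≗ onePlus b (onePlus a g)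
onePlus-comm a b g zero = exchange (g 0) a b
  where
  exchange : ∀ x a b → x + b * 0 + a * 0 ≡ x + a * 0 + b * 0
  exchange = solve-∀
onePlus-comm a b g (suc i) = exchange (g (suc i)) (g i) (shift g i) a b
  where
  exchange : ∀ x y z a b → x + b * y + a * (y + b * z) ≡ x + a * y + b * (y + a * z)
  exchange = solve-∀

onePlusPow-onePlus : ∀ c N c′ g → onePlusPow c N (onePlus c′ g) ≗ onePlus c′ (onePlusPow c N g)
onePlusPow-onePlus c zero c′ g i = refl
onePlusPow-onePlus c (suc N) c′ g i =
  trans (onePlus-cong c (onePlusPow-onePlus c N c′ g) i) (onePlus-comm c c′ (onePlusPow c N g) i)

onePlus2-square : ∀ g → onePlus 2 (onePlus 2 g) ≗ addShifted 4 g (onePlus 1 g)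
onePlus2-square g zero = square (g 0)
  where
  square : ∀ x → x + 2 * 0 + 2 * 0 ≡ x + 4 * 0
  square = solve-∀
onePlus2-square g (suc zero) = square (g 1) (g 0)
  where
  square : ∀ x y → x + 2 * y + 2 * (y + 2 * 0) ≡ x + 4 * (y + 1 * 0)
  square = solve-∀
onePlus2-square g (suc (suc i)) = square (g (suc (suc i))) (g (suc i)) (g i)
  where
  square : ∀ x y z → x + 2 * y + 2 * (y + 2 * z) ≡ x + 4 * (y + 1 * z)
  square = solve-∀

onePlusPow-one : ∀ k → onePlusPow 1 k one ≗ (k C_)
onePlusPow-one zero zero = refl
onePlusPow-one zero (suc i) = refl
onePlusPow-one (suc k) zero = cong (λ u → u + 1 * 0) (onePlusPow-one k zero)
onePlusPow-one (suc k) (suc i) = begin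
  onePlusPow 1 k one (suc i) + 1 * onePlusPow 1 k one i ≡⟨ cong₂ (λ u v → u + 1 * v) (onePlusPow-one k (suc i)) (onePlusPow-one k i) ⟩
  k C suc i + 1 * (k C i)                               ≡⟨ cong (_+_ (k C suc i)) (ℕₚ.*-identityˡ (k C i)) ⟩
  k C suc i + k C i                                     ≡⟨ ℕₚ.+-comm (k C suc i) (k C i) ⟩
  k C i + k C suc i                                     ≡⟨ nCk+nC[k+1]≡[n+1]C[k+1] k i ⟩
  suc k C suc i                                         ∎
  where open ≡-Reasoning

-- The sum is padded to any length M > N (the extra terms vanish), so that the
-- induction step can use the hypothesis at two different lengths.
onePlusPow-binomial : ∀ c N h M → N ℕ.< M → ∀ i →
  onePlusPow c N h i ≡ sum {M} (λ j → (N C toℕ j) * c ^ toℕ j * shiftBy (toℕ j) h i)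
onePlusPow-binomial c zero h (suc M) _ i = sym (begin
  sum {suc M} (λ j → (0 C toℕ j) * c ^ toℕ j * shiftBy (toℕ j) h i) ≡⟨⟩
  1 * 1 * h i + sum {M} (λ _ → 0) ≡⟨ cong (_+_ (1 * 1 * h i)) (sum-replicate-zero M) ⟩
  1 * 1 * h i + 0                 ≡⟨ ℕₚ.+-identityʳ (1 * 1 * h i) ⟩
  1 * 1 * h i                     ≡⟨ ℕₚ.*-identityˡ (h i) ⟩
  h i                             ∎)
  where open ≡-Reasoning
onePlusPow-binomial c (suc N) h (suc M) (s≤s N<M) i = begin
  P i + c * shift P i
    ≡⟨ cong₂ (λ u v → u + c * v) (onePlusPow-binomial c N h (suc M) (ℕₚ.m<n⇒m<1+n N<M) i) (shift-P i) ⟩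
  T zero + sum (λ j → T (suc j)) + c * sum U
    ≡⟨ ℕₚ.+-assoc (T zero) _ _ ⟩
  T zero + (sum (λ j → T (suc j)) + c * sum U)
    ≡⟨ cong (_+_ (T zero)) (sym (sum-linear ℕₚ.+-*-semiring (λ j → T (suc j)) U c)) ⟩
  T zero + sum (λ j → T (suc j) + c * U j)
    ≡⟨ cong (_+_ (T zero)) (sum-cong-≗ pascal) ⟩
  sum {suc M} (λ j → (suc N C toℕ j) * c ^ toℕ j * S (toℕ j))
    ∎
  where
  open ≡-Reasoning
  P : Seq
  P = onePlusPow c N h
  S : ℕ → ℕ
  S j = shiftBy j h i
  T : Fin (suc M) → ℕ
  T j = (N C toℕ j) * c ^ toℕ j * S (toℕ j)
  U : Fin M → ℕ
  U j = (N C toℕ j) * c ^ toℕ j * S (suc (toℕ j))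
  shift-P : ∀ i → shift P i ≡ sum {M} (λ j → (N C toℕ j) * c ^ toℕ j * shiftBy (suc (toℕ j)) h i)
  shift-P zero = sym (sum-zero ℕₚ.+-*-semiring {M} (λ j → (N C toℕ j) * c ^ toℕ j * shiftBy (suc (toℕ j)) h zero)
    λ j → ℕₚ.*-zeroʳ ((N C toℕ j) * c ^ toℕ j))
  shift-P (suc i) = onePlusPow-binomial c N h M N<M i
  pascal : ∀ j → T (suc j) + c * U j ≡ (suc N C suc (toℕ j)) * c ^ suc (toℕ j) * S (suc (toℕ j))
  pascal j = begin
    (N C suc (toℕ j)) * (c * c ^ toℕ j) * S (suc (toℕ j)) + c * ((N C toℕ j) * c ^ toℕ j * S (suc (toℕ j)))
      ≡⟨ rearrange (N C toℕ j) (N C suc (toℕ j)) c (c ^ toℕ j) (S (suc (toℕ j))) ⟩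
    (N C toℕ j + N C suc (toℕ j)) * (c * c ^ toℕ j) * S (suc (toℕ j))
      ≡⟨ cong (λ u → u * (c * c ^ toℕ j) * S (suc (toℕ j))) (nCk+nC[k+1]≡[n+1]C[k+1] N (toℕ j)) ⟩
    (suc N C suc (toℕ j)) * (c * c ^ toℕ j) * S (suc (toℕ j))
      ∎
    where
    rearrange : ∀ x y c p s → y * (c * p) * s + c * (x * p * s) ≡ (x + y) * (c * p) * s
    rearrange = solve-∀

column : ℕ → ℕ → ℕ → Seq
column k a b = shiftBy k (onePlusPow 2 b (onePlusPow 1 a one))

column-step₂ : ∀ k a b i → column k a b i + 2 * column (suc k) a b i ≡ column k a (suc b) i
column-step₂ k a b i = sym (shiftBy-addShifted k 2 P P i)
  where
  P : Seq
  P = onePlusPow 2 b (onePlusPow 1 a one)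

column-step₁ : ∀ k a b i → column k a b i + 1 * column (suc k) a b i ≡ column k (suc a) b i
column-step₁ k a b i =
  trans (sym (shiftBy-addShifted k 1 P P i)) (sym (shiftBy-cong k (onePlusPow-onePlus 2 b 1 (onePlusPow 1 a one)) i))
  where
  P : Seq
  P = onePlusPow 2 b (onePlusPow 1 a one)

column-step₄ : ∀ k b i → column k k b i + 4 * column (suc k) (suc k) b i ≡ column k k (suc (suc b)) i
column-step₄ k b i = begin
  shiftBy k P i + 4 * column (suc k) (suc k) b i
    ≡⟨ cong (λ v → shiftBy k P i + 4 * v) (shiftBy-cong (suc k) (onePlusPow-onePlus 2 b 1 H) i) ⟩
  shiftBy k P i + 4 * shiftBy (suc k) (onePlus 1 P) i
    ≡⟨ shiftBy-addShifted k 4 P (onePlus 1 P) i ⟨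
  shiftBy k (addShifted 4 P (onePlus 1 P)) i
    ≡⟨ shiftBy-cong k (onePlus2-square P) i ⟨
  column k k (suc (suc b)) i
    ∎
  where
  open ≡-Reasoning
  H : Seq
  H = onePlusPow 1 k one
  P : Seq
  P = onePlusPow 2 b H

sum-applyUpTo : ∀ n (f g : ℕ → ℕ) → ListAction.sum (List.map f (List.applyUpTo g n)) ≡ sum {n} (λ j → f (g (toℕ j)))
sum-applyUpTo zero f g = refl
sum-applyUpTo (suc n) f g = cong (_+_ (f (g 0))) (sum-applyUpTo n f (λ j → g (suc j)))

binomialTerm≡gammaTerm : ∀ d i k j → ((d ∸ 2 * k) C j) * 2 ^ j * shiftBy j (column k k 0) i ≡ gammaTerm d i k j
binomialTerm≡gammaTerm d i k j
  rewrite shiftBy-shiftBy j k (onePlusPow 1 k one) i | ℕₚ.+-comm j k | shiftBy-≤ᵇ (k + j) (onePlusPow 1 k one) i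
  with k + j ℕ.≤ᵇ i
... | false = ℕₚ.*-zeroʳ (((d ∸ 2 * k) C j) * 2 ^ j)
... | true = trans (cong (((d ∸ 2 * k) C j) * 2 ^ j *_) (onePlusPow-one k (i ∸ (k + j))))
                   (rotate ((d ∸ 2 * k) C j) (2 ^ j) (k C (i ∸ (k + j))))
  where
  rotate : ∀ x y z → x * y * z ≡ z * x * y
  rotate = solve-∀

gammaEntry≡column : ∀ d i k → gammaEntry d i k ≡ column k k (d ∸ 2 * k) i
gammaEntry≡column d i k = begin
  gammaEntry d i k
    ≡⟨ sum-applyUpTo (suc N) (gammaTerm d i k) id ⟩
  sum {suc N} (λ j → gammaTerm d i k (toℕ j))
    ≡⟨ sum-cong-≗ {suc N} (λ j → binomialTerm≡gammaTerm d i k (toℕ j)) ⟨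
  sum {suc N} (λ j → (N C toℕ j) * 2 ^ toℕ j * shiftBy (toℕ j) (column k k 0) i)
    ≡⟨ onePlusPow-binomial 2 N (column k k 0) (suc N) ℕₚ.≤-refl i ⟨
  onePlusPow 2 N (column k k 0) i
    ≡⟨ shiftBy-onePlusPow k 2 N (onePlusPow 1 k one) i ⟨
  column k k N i
    ∎
  where
  open ≡-Reasoning
  N : ℕ
  N = d ∸ 2 * k

-- Totally non-negative infinite matrices

-- Matrices are stored by columns: the entry in row i and column k of A is A k i.
Mat : Set
Mat = ℕ → Seq

minorOf : Mat → ∀ m → (Fin m → ℕ) → (Fin m → ℕ) → ℤ
minorOf A m rows cols = det m (λ a b → + A (cols b) (rows a))

TotallyNonNegative∞ : Mat → Set
TotallyNonNegative∞ A = ∀ m (rows cols : Fin m → ℕ) → Increasing rows → Increasing cols →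
  0ℤ ℤ.≤ minorOf A m rows cols

TN∞⇒TotallyNonNegative : ∀ {p q} {M : Fin p → Fin q → ℤ} {A : Mat} → TotallyNonNegative∞ A →
  (∀ i k → M i k ≡ + A (toℕ k) (toℕ i)) → TotallyNonNegative M
TN∞⇒TotallyNonNegative tnA M≡A m rows cols rows↑ cols↑ =
  subst (0ℤ ℤ.≤_) (det-cong m λ a b → sym (M≡A (rows a) (cols b)))
    (tnA m (toℕ ∘ rows) (toℕ ∘ cols) (λ {a} {b} → rows↑ a b) (λ {a} {b} → cols↑ a b))

unit : Mat
unit k = shiftBy k one

unit-diagonal : ∀ k → unit k k ≡ 1
unit-diagonal zero = refl
unit-diagonal (suc k) = unit-diagonal k

unit-offDiagonal : ∀ k i → i ≢ k → unit k i ≡ 0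
unit-offDiagonal zero zero i≢k = ⊥-elim (i≢k refl)
unit-offDiagonal zero (suc i) i≢k = refl
unit-offDiagonal (suc k) zero i≢k = refl
unit-offDiagonal (suc k) (suc i) i≢k = unit-offDiagonal k i (i≢k ∘ cong suc)

TN∞-unit : TotallyNonNegative∞ unit
TN∞-unit zero rows cols rows↑ cols↑ = ℤ.+≤+ z≤n
TN∞-unit (suc m) rows cols rows↑ cols↑ with ℕₚ.<-cmp (rows zero) (cols zero)
... | tri< r₀<c₀ _ _ = ℤₚ.≤-reflexive (sym (det-zeroFirstRow m (λ a b → + unit (cols b) (rows a)) λ j →
  cong +_ (unit-offDiagonal (cols j) (rows zero) (ℕₚ.<⇒≢ (ℕₚ.<-≤-trans r₀<c₀ (increasing-≥-first cols↑ j))))))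
... | tri> _ _ c₀<r₀ = ℤₚ.≤-reflexive (sym (det-zeroColumn (suc m) zero (λ a b → + unit (cols b) (rows a)) λ a →
  cong +_ (unit-offDiagonal (cols zero) (rows a) (ℕₚ.>⇒≢ (ℕₚ.<-≤-trans c₀<r₀ (increasing-≥-first rows↑ a))))))
... | tri≈ _ r₀≡c₀ _ = subst (0ℤ ℤ.≤_) (sym (det-unitFirstRow m (λ a b → + unit (cols b) (rows a)) diagonal off-diagonal))
  (TN∞-unit m (λ a → rows (suc a)) (λ b → cols (suc b)) (rows↑ ∘ s≤s) (cols↑ ∘ s≤s))
  where
  diagonal : + unit (cols zero) (rows zero) ≡ + 1
  diagonal = cong +_ (trans (cong (unit (cols zero)) r₀≡c₀) (unit-diagonal (cols zero)))
  off-diagonal : ∀ j → + unit (cols (suc j)) (rows zero) ≡ 0ℤ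
  off-diagonal j = cong +_ (unit-offDiagonal (cols (suc j)) (rows zero)
    (ℕₚ.<⇒≢ (subst (ℕ._< cols (suc j)) (sym r₀≡c₀) (cols↑ (s≤s z≤n)))))

nonNeg-+-scaled : ∀ {x y} c → 0ℤ ℤ.≤ x → 0ℤ ℤ.≤ y → 0ℤ ℤ.≤ x ℤ.+ + c ℤ.* y
nonNeg-+-scaled {y = y} c 0≤x 0≤y =
  ℤₚ.+-mono-≤ 0≤x (subst (ℤ._≤ + c ℤ.* y) (ℤₚ.*-zeroʳ (+ c)) (ℤₚ.*-monoˡ-≤-nonNeg (+ c) 0≤y))

pos-+-* : ∀ x c y → + (x + c * y) ≡ + x ℤ.+ + c ℤ.* + y
pos-+-* x c y = trans (ℤₚ.pos-+ x (c * y)) (cong (ℤ._+_ (+ x)) (ℤₚ.pos-* c y))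

TN∞-addNextToColumn : ∀ {A B : Mat} K c → TotallyNonNegative∞ A →
  (∀ k → k ≢ K → B k ≗ A k) → (∀ i → B K i ≡ A K i + c * A (suc K) i) → TotallyNonNegative∞ B
TN∞-addNextToColumn {A} {B} K c tnA B≗A B≗A+cA m rows cols rows↑ cols↑
  with Finₚ.any? (λ b → cols b ℕ.≟ K)
... | no K∉cols = subst (0ℤ ℤ.≤_) (det-cong m λ a b → cong +_ (sym (B≗A (cols b) (λ e → K∉cols (b , e)) (rows a))))
  (tnA m rows cols rows↑ cols↑)
... | yes (b₀ , refl) =
  subst (0ℤ ℤ.≤_) (sym linear) (nonNeg-+-scaled c (tnA m rows cols rows↑ cols↑) bumped-nonNeg)
  where
  cols′ : Fin m → ℕ
  cols′ = updateAt cols b₀ suc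
  outside : ∀ b → b ≢ b₀ → cols b ≢ cols b₀
  outside b b≢b₀ = b≢b₀ ∘ increasing-injective cols↑
  linear : minorOf B m rows cols ≡ minorOf A m rows cols ℤ.+ + c ℤ.* minorOf A m rows cols′
  linear = det-linear m b₀ (+ c) _ _ _
    (λ a b b≢b₀ → cong +_ (B≗A (cols b) (outside b b≢b₀) (rows a)))
    (λ a b b≢b₀ → cong +_ (trans (B≗A (cols b) (outside b b≢b₀) (rows a))
                                  (cong (λ k → A k (rows a)) (sym (updateAt-minimal b b₀ cols b≢b₀)))))
    (λ a → trans (cong +_ (B≗A+cA (rows a))) (trans (pos-+-* _ c _)
      (cong (λ k → + A (cols b₀) (rows a) ℤ.+ + c ℤ.* + A k (rows a)) (sym (updateAt-updates b₀ cols)))))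
  bumped-nonNeg : 0ℤ ℤ.≤ minorOf A m rows cols′
  bumped-nonNeg with Finₚ.any? (λ b → cols b ℕ.≟ suc (cols b₀))
  ... | no fresh = tnA m rows cols′ rows↑ (increasing-updateAt-suc b₀ cols↑ (λ b e → fresh (b , e)))
  ... | yes (b₁ , consecutive) = ℤₚ.≤-reflexive (sym (det-equalConsecutiveColumns m _ cols↑ b₀ b₁ consecutive
      λ a → cong (λ k → + A k (rows a))
        (trans (updateAt-updates b₀ cols) (trans (sym consecutive) (sym (updateAt-minimal b₁ b₀ cols b₁≢b₀))))))
    where
    b₁≢b₀ : b₁ ≢ b₀
    b₁≢b₀ refl = ℕₚ.1+n≢n (sym consecutive)

addNext : (ℕ → ℕ) → Mat → Mat
addNext c A k i = A k i + c k * A (suc k) i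

addNext-inactive : ∀ c A k → c k ≡ 0 → addNext c A k ≗ A k
addNext-inactive c A k cₖ≡0 i = trans (cong (λ u → A k i + u * A (suc k) i) cₖ≡0) (ℕₚ.+-identityʳ (A k i))

-- addNext on the columns below q, one column at a time from the left, so that
-- each step still reads an unmodified next column
addNextBelow : (ℕ → ℕ) → ℕ → Mat → Mat
addNextBelow c zero A = A
addNextBelow c (suc q) A k with k ℕ.≟ q
... | yes _ = addNext c A k
... | no _ = addNextBelow c q A k

addNextBelow-above : ∀ c q A k → q ℕ.≤ k → addNextBelow c q A k ≗ A k
addNextBelow-above c zero A k q≤k i = refl
addNextBelow-above c (suc q) A k q<k i with k ℕ.≟ q
... | yes refl = ⊥-elim (ℕₚ.<-irrefl refl q<k)
... | no _ = addNextBelow-above c q A k (ℕₚ.<⇒≤ q<k) i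

addNextBelow-below : ∀ c q A k → k ℕ.< q → addNextBelow c q A k ≗ addNext c A k
addNextBelow-below c (suc q) A k k<q+1 i with k ℕ.≟ q
... | yes _ = refl
... | no k≢q = addNextBelow-below c q A k (ℕₚ.≤∧≢⇒< (ℕ.s≤s⁻¹ k<q+1) k≢q) i

TN∞-addNextBelow : ∀ c q A → TotallyNonNegative∞ A → TotallyNonNegative∞ (addNextBelow c q A)
TN∞-addNextBelow c zero A tnA = tnA
TN∞-addNextBelow c (suc q) A tnA =
  TN∞-addNextToColumn q (c q) (TN∞-addNextBelow c q A tnA) unchanged updated
  where
  unchanged : ∀ k → k ≢ q → addNextBelow c (suc q) A k ≗ addNextBelow c q A k
  unchanged k k≢q i with k ℕ.≟ q
  ... | yes k≡q = ⊥-elim (k≢q k≡q)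
  ... | no _ = refl
  updated : ∀ i → addNextBelow c (suc q) A q i ≡ addNextBelow c q A q i + c q * addNextBelow c q A (suc q) i
  updated i with q ℕ.≟ q
  ... | no q≢q = ⊥-elim (q≢q refl)
  ... | yes _ = sym (cong₂ (λ u v → u + c q * v)
    (addNextBelow-above c q A q ℕₚ.≤-refl i) (addNextBelow-above c q A (suc q) (ℕₚ.n≤1+n q) i))

TN∞-addNext : ∀ c A → TotallyNonNegative∞ A → TotallyNonNegative∞ (addNext c A)
TN∞-addNext c A tnA zero rows cols rows↑ cols↑ = ℤ.+≤+ z≤n
TN∞-addNext c A tnA (suc m) rows cols rows↑ cols↑ =
  subst (0ℤ ℤ.≤_) (det-cong (suc m) λ a b → cong +_ (addNextBelow-below c q A (cols b) (s≤s (increasing-≤-last cols↑ b)) (rows a)))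
    (TN∞-addNextBelow c q A tnA (suc m) rows cols rows↑ cols↑)
  where
  q : ℕ
  q = suc (cols (Fin.fromℕ m))

[_≤_] : ℕ → ℕ → ℕ
[ s ≤ k ] with s ℕ.≤? k
... | yes _ = 1
... | no _ = 0

[≤]-yes : ∀ {s k} → s ℕ.≤ k → [ s ≤ k ] ≡ 1
[≤]-yes {s} {k} s≤k with s ℕ.≤? k
... | yes _ = refl
... | no s≰k = ⊥-elim (s≰k s≤k)

[≤]-no : ∀ {s k} → k ℕ.< s → [ s ≤ k ] ≡ 0
[≤]-no {s} {k} k<s with s ℕ.≤? k
... | yes s≤k = ⊥-elim (ℕₚ.<⇒≱ k<s s≤k)
... | no _ = refl

stage₁ : ℕ → Mat
stage₁ zero = unit
stage₁ (suc b) = addNext (λ _ → 2) (stage₁ b)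

stage₁-column : ∀ b k → stage₁ b k ≗ column k 0 b
stage₁-column zero k i = refl
stage₁-column (suc b) k i =
  trans (cong₂ (λ u v → u + 2 * v) (stage₁-column b k i) (stage₁-column b (suc k) i)) (column-step₂ k 0 b i)

TN∞-stage₁ : ∀ b → TotallyNonNegative∞ (stage₁ b)
TN∞-stage₁ zero = TN∞-unit
TN∞-stage₁ (suc b) = TN∞-addNext (λ _ → 2) (stage₁ b) (TN∞-stage₁ b)

stage₂ : ℕ → ℕ → Mat
stage₂ b zero = stage₁ b
stage₂ b (suc a) = addNext (λ k → [ suc a ≤ k ]) (stage₂ b a)

stage₂-column : ∀ b a k → stage₂ b a k ≗ column k (k ⊓ a) b
stage₂-column b zero k i rewrite ℕₚ.⊓-zeroʳ k = stage₁-column b k i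
stage₂-column b (suc a) k i with ℕₚ.≤-<-connex k a
... | inj₁ k≤a = begin
  stage₂ b (suc a) k i      ≡⟨ addNext-inactive (λ k → [ suc a ≤ k ]) (stage₂ b a) k ([≤]-no (s≤s k≤a)) i ⟩
  stage₂ b a k i            ≡⟨ stage₂-column b a k i ⟩
  column k (k ⊓ a) b i      ≡⟨ cong (λ a′ → column k a′ b i) (trans (ℕₚ.m≤n⇒m⊓n≡m k≤a) (sym (ℕₚ.m≤n⇒m⊓n≡m (ℕₚ.m≤n⇒m≤1+n k≤a)))) ⟩
  column k (k ⊓ suc a) b i  ∎
  where open ≡-Reasoning
... | inj₂ a<k = begin
  stage₂ b a k i + [ suc a ≤ k ] * stage₂ b a (suc k) i
    ≡⟨ cong₂ (λ u v → u + v * stage₂ b a (suc k) i) (stage₂-column b a k i) ([≤]-yes a<k) ⟩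
  column k (k ⊓ a) b i + 1 * stage₂ b a (suc k) i
    ≡⟨ cong (λ v → column k (k ⊓ a) b i + 1 * v) (stage₂-column b a (suc k) i) ⟩
  column k (k ⊓ a) b i + 1 * column (suc k) (suc k ⊓ a) b i
    ≡⟨ cong₂ (λ u v → column k u b i + 1 * column (suc k) v b i)
             (ℕₚ.m≥n⇒m⊓n≡n (ℕₚ.<⇒≤ a<k)) (ℕₚ.m≥n⇒m⊓n≡n (ℕₚ.m≤n⇒m≤1+n (ℕₚ.<⇒≤ a<k))) ⟩
  column k a b i + 1 * column (suc k) a b i
    ≡⟨ column-step₁ k a b i ⟩
  column k (suc a) b i
    ≡⟨ cong (λ a′ → column k a′ b i) (ℕₚ.m≥n⇒m⊓n≡n a<k) ⟨
  column k (k ⊓ suc a) b i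
    ∎
  where open ≡-Reasoning

TN∞-stage₂ : ∀ b a → TotallyNonNegative∞ (stage₂ b a)
TN∞-stage₂ b zero = TN∞-stage₁ b
TN∞-stage₂ b (suc a) = TN∞-addNext (λ k → [ suc a ≤ k ]) (stage₂ b a) (TN∞-stage₂ b a)

stage₃ : ℕ → Mat → Mat
stage₃ zero A = A
stage₃ (suc m) A = stage₃ m (addNext (λ k → 4 * [ k ≤ m ]) A)

stage₃-above : ∀ m A k → m ℕ.≤ k → stage₃ m A k ≗ A k
stage₃-above zero A k _ i = refl
stage₃-above (suc m) A k m<k i = trans (stage₃-above m _ k (ℕₚ.<⇒≤ m<k) i)
  (addNext-inactive (λ k → 4 * [ k ≤ m ]) A k (cong (4 *_) ([≤]-no m<k)) i)

stage₃-column : ∀ m A b → (∀ k → k ℕ.≤ m → A k ≗ column k k b) →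
  ∀ k j → k + j ≡ m → stage₃ m A k ≗ column k k (2 * j + b)
stage₃-column zero A b A-column k j k+j≡0 i rewrite ℕₚ.m+n≡0⇒n≡0 k k+j≡0 =
  A-column k (ℕₚ.≤-reflexive (ℕₚ.m+n≡0⇒m≡0 k k+j≡0)) i
stage₃-column (suc m) A b A-column k zero k+0≡m+1 i = begin
  stage₃ m A′ k i    ≡⟨ stage₃-above m A′ k (subst (m ℕ.≤_) (sym k≡m+1) (ℕₚ.n≤1+n m)) i ⟩
  A′ k i             ≡⟨ addNext-inactive (λ k → 4 * [ k ≤ m ]) A k (cong (4 *_) ([≤]-no (ℕₚ.≤-reflexive (sym k≡m+1)))) i ⟩
  A k i              ≡⟨ A-column k (ℕₚ.≤-reflexive k≡m+1) i ⟩
  column k k b i     ∎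
  where
  open ≡-Reasoning
  A′ : Mat
  A′ = addNext (λ k → 4 * [ k ≤ m ]) A
  k≡m+1 : k ≡ suc m
  k≡m+1 = trans (sym (ℕₚ.+-identityʳ k)) k+0≡m+1
stage₃-column (suc m) A b A-column k (suc j) k+j+1≡m+1 i =
  trans (stage₃-column m A′ (suc (suc b)) A′-column k j k+j≡m i) (cong (λ e → column k k e i) (exponent j b))
  where
  A′ : Mat
  A′ = addNext (λ k → 4 * [ k ≤ m ]) A
  k+j≡m : k + j ≡ m
  k+j≡m = ℕₚ.suc-injective (trans (sym (ℕₚ.+-suc k j)) k+j+1≡m+1)
  exponent : ∀ j b → 2 * j + suc (suc b) ≡ 2 * suc j + b
  exponent = solve-∀
  A′-column : ∀ k → k ℕ.≤ m → A′ k ≗ column k k (suc (suc b))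
  A′-column k k≤m i = begin
    A k i + 4 * [ k ≤ m ] * A (suc k) i
      ≡⟨ cong₂ (λ u v → A k i + 4 * u * v) ([≤]-yes k≤m) (A-column (suc k) (s≤s k≤m) i) ⟩
    A k i + 4 * column (suc k) (suc k) b i
      ≡⟨ cong (λ u → u + 4 * column (suc k) (suc k) b i) (A-column k (ℕₚ.m≤n⇒m≤1+n k≤m) i) ⟩
    column k k b i + 4 * column (suc k) (suc k) b i
      ≡⟨ column-step₄ k b i ⟩
    column k k (suc (suc b)) i
      ∎
    where open ≡-Reasoning

TN∞-stage₃ : ∀ m A → TotallyNonNegative∞ A → TotallyNonNegative∞ (stage₃ m A)
TN∞-stage₃ zero A tnA = tnA
TN∞-stage₃ (suc m) A tnA = TN∞-stage₃ m _ (TN∞-addNext (λ k → 4 * [ k ≤ m ]) A tnA)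

gammaMatrix : ℕ → Mat
gammaMatrix d = stage₃ (d / 2) (stage₂ (d % 2) (d / 2))

TN∞-gammaMatrix : ∀ d → TotallyNonNegative∞ (gammaMatrix d)
TN∞-gammaMatrix d = TN∞-stage₃ (d / 2) (stage₂ (d % 2) (d / 2)) (TN∞-stage₂ (d % 2) (d / 2))

exponent-of-1+2x : ∀ d e n k j → d ≡ e + n * 2 → k + j ≡ n → 2 * j + e ≡ d ∸ 2 * k
exponent-of-1+2x _ e _ k j refl refl =
  sym (trans (cong (_∸ 2 * k) (rearrange e k j)) (ℕₚ.m+n∸n≡m (2 * j + e) (2 * k)))
  where
  rearrange : ∀ e k j → e + (k + j) * 2 ≡ 2 * j + e + 2 * k
  rearrange = solve-∀

gammaMatrix-entry : ∀ d i k → k ℕ.≤ d / 2 → gammaMatrix d k i ≡ gammaEntry d i k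
gammaMatrix-entry d i k k≤n = begin
  gammaMatrix d k i              ≡⟨ stage₃-column n (stage₂ e n) e stage₂-diagonal k (n ∸ k) k+[n∸k]≡n i ⟩
  column k k (2 * (n ∸ k) + e) i ≡⟨ cong (λ N → column k k N i) (exponent-of-1+2x d e n k (n ∸ k) (m≡m%n+[m/n]*n d 2) k+[n∸k]≡n) ⟩
  column k k (d ∸ 2 * k) i       ≡⟨ gammaEntry≡column d i k ⟨
  gammaEntry d i k               ∎
  where
  open ≡-Reasoning
  n : ℕ
  n = d / 2
  e : ℕ
  e = d % 2
  k+[n∸k]≡n : k + (n ∸ k) ≡ n
  k+[n∸k]≡n = ℕₚ.m+[n∸m]≡n k≤n
  stage₂-diagonal : ∀ k → k ℕ.≤ n → stage₂ e n k ≗ column k k e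
  stage₂-diagonal k k≤n i = trans (stage₂-column e n k i) (cong (λ a → column k a e i) (ℕₚ.m≤n⇒m⊓n≡m k≤n))

mainTheorem3 : (d : ℕ) → TotallyNonNegative (Mγ d)
mainTheorem3 d = TN∞⇒TotallyNonNegative {A = gammaMatrix d} (TN∞-gammaMatrix d)
  λ i k → cong +_ (sym (gammaMatrix-entry d (toℕ i) (toℕ k) (ℕ.s≤s⁻¹ (Finₚ.toℕ<n k))))
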